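{- Let $\tilde{\epsilon} \in (0,1)$ be a constant and let $n, b, N$ be positive integers with $n \leq b^{1-\tilde{\epsilon}}$. Then there exist $K = O(\tilde{\epsilon}^{ -1} \log_b N)$ partitions $P^{(1)}, \dots, P^{(K)}$ of $[N]$, each into $b$ parts, $P^{(i)} = (S^{(i)}_1, \dots, S^{(i)}_b)$, such that for every nonempty subset $V \subseteq [N]$ with $|V| \le n$ there exist $i \in [K]$ and $j \in [b]$ with $|S^{(i)}_j \cap V| = 1$.
   Context: $[N] = \{1,\dots,N\}$. A partition of $[N]$ into $b$ parts is a tuple $(S_1,\dots,S_b)$ of pairwise disjoint subsets of $[N]$ (parts may be empty) whose union is $[N]$.
   Formalization: The constant $\tilde{\epsilon}$ ranges only over the rationals in $(0,1)$. -}

module Defs where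

open import Data.Nat using (ℕ)
open import Data.Fin using (Fin)
open import Data.Fin.Subset using (Subset; _∈_)
open import Data.Product using (∃)
open import Relation.Binary.PropositionalEquality using (_≡_)

record Partition (N b : ℕ) : Set where
  field
    part     : Fin b → Subset N
    disjoint : ∀ (j k : Fin b) (x : Fin N) → x ∈ part j → x ∈ part k → j ≡ k
    covers   : ∀ (x : Fin N) → ∃ λ j → x ∈ part j

open Partition public

module Submission where

-- Each b-colouring of [N] gives a partition into its colour classes, and it isolates a point of V
-- when some class meets V in exactly one point.  For |V| = v ≥ 2, colour the points of V one at a
-- time and track the number r of points still to come, u of classes holding one point and t of
-- classes holding at least two: every singleton class must be hit again, and every further pair of
-- points costs about v·b, so at most b^(N-v)·(v b)^(v/2) colourings (up to a constant) isolate no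
-- point of V.  Cubing absorbs the constant and bounds the failure rate of a uniform colouring by
-- (n/b)^(v/3).  Take K = 3(L+1) colourings, L+1 being the first exponent with
-- 4N·(n/b)^(L+1) ≤ 1; a union bound over all V, weighted by (n/b)^((L+1)|V|), totals at most
-- (1 + (n/b)^(L+1))^N - 1 ≤ 1/3, so some K-tuple isolates every admissible V.  Minimality of L
-- and n^q ≤ b^(q-p) give b^(pL) < (4N)^q, i.e. K = O((q/p) log_b N).  Probabilities are replaced
-- by exact counts throughout.

open import Data.Bool using (true; false; if_then_else_)
open import Data.Fin using (Fin; zero; suc)
open import Data.Fin.Properties using (_≟_)
open import Data.Fin.Subset using (Subset; _∩_; ∣_∣; Nonempty; ∁; _∈_)
open import Data.Fin.Subset.Properties using (∣p∣≤n; ∣∁p∣≡n∸∣p∣; x∈p⇒∣p-x∣<∣p∣)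
open import Data.List using (List; []; _∷_; _++_; map; concatMap; length; tabulate; allFin)
open import Data.List.Membership.Propositional using () renaming (_∈_ to _∈ˡ_)
open import Data.List.Membership.Propositional.Properties using (∈-allFin; ∈-concatMap⁺; ∈-map⁺)
open import Data.List.Properties using (length-tabulate)
open import Data.List.Relation.Unary.Any using (here; there)
import Data.List.Relation.Unary.Any as Any
open import Data.Nat hiding (_≟_)
open import Data.Nat.Properties hiding (_≟_)
open import Algebra.Properties.CommutativeSemigroup +-commutativeSemigroup using () renaming (interchange to +-interchange)
open import Algebra.Properties.CommutativeSemigroup *-commutativeSemigroup using (x∙yz≈y∙xz)
open import Data.Nat.Tactic.RingSolver using (solve-∀)
open import Data.Product using (Σ; ∃; _×_; _,_; proj₁; proj₂)
open import Data.Sum using (inj₁; inj₂)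
open import Data.Vec using (Vec; []; _∷_; lookup; replicate)
import Data.Vec as Vec
open import Data.Vec.Properties using (lookup-map; []=⇒lookup; lookup⇒[]=)
open import Defs
open import Function using (_∘_; id)
open import Relation.Binary.PropositionalEquality
open import Relation.Nullary using (¬_; Dec; does; yes; no; contradiction)
open import Relation.Nullary.Decidable using (dec-true)
open import Relation.Unary using (Decidable)

-- Finite sums over lists

module _ {A : Set} where

  ∑ : List A → (A → ℕ) → ℕ
  ∑ []       f = 0
  ∑ (x ∷ xs) f = f x + ∑ xs f

  syntax ∑ xs (λ x → e) = ∑[ x ← xs ] e

  ∑-cong : ∀ xs {f g : A → ℕ} → (∀ x → f x ≡ g x) → ∑ xs f ≡ ∑ xs g
  ∑-cong []       eq = refl
  ∑-cong (x ∷ xs) eq = cong₂ _+_ (eq x) (∑-cong xs eq)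

  ∑-mono-≤ : ∀ xs {f g : A → ℕ} → (∀ x → f x ≤ g x) → ∑ xs f ≤ ∑ xs g
  ∑-mono-≤ []       le = z≤n
  ∑-mono-≤ (x ∷ xs) le = +-mono-≤ (le x) (∑-mono-≤ xs le)

  ∑-distrib-+ : ∀ xs (f g : A → ℕ) → ∑[ x ← xs ] (f x + g x) ≡ ∑ xs f + ∑ xs g
  ∑-distrib-+ []       f g = refl
  ∑-distrib-+ (x ∷ xs) f g =
    trans (cong (f x + g x +_) (∑-distrib-+ xs f g)) (+-interchange (f x) (g x) (∑ xs f) (∑ xs g))

  ∑-*ˡ : ∀ xs k (f : A → ℕ) → ∑[ x ← xs ] (k * f x) ≡ k * ∑ xs f
  ∑-*ˡ []       k f = sym (*-zeroʳ k)
  ∑-*ˡ (x ∷ xs) k f = trans (cong (k * f x +_) (∑-*ˡ xs k f)) (sym (*-distribˡ-+ k (f x) (∑ xs f)))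

  ∑-*ʳ : ∀ xs k (f : A → ℕ) → ∑[ x ← xs ] (f x * k) ≡ ∑ xs f * k
  ∑-*ʳ xs k f = trans (∑-cong xs (λ x → *-comm (f x) k)) (trans (∑-*ˡ xs k f) (*-comm k (∑ xs f)))

  ∑-const : ∀ xs k → ∑[ _ ← xs ] k ≡ length xs * k
  ∑-const []       k = refl
  ∑-const (x ∷ xs) k = cong (k +_) (∑-const xs k)

  length≡∑1 : ∀ xs → length xs ≡ ∑[ _ ← xs ] 1
  length≡∑1 xs = sym (trans (∑-const xs 1) (*-identityʳ (length xs)))

  ∑-0 : ∀ xs → ∑[ _ ← xs ] 0 ≡ 0
  ∑-0 xs = trans (∑-const xs 0) (*-zeroʳ (length xs))

  ∑-++ : ∀ xs ys (f : A → ℕ) → ∑ (xs ++ ys) f ≡ ∑ xs f + ∑ ys f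
  ∑-++ []       ys f = refl
  ∑-++ (x ∷ xs) ys f = trans (cong (f x +_) (∑-++ xs ys f)) (sym (+-assoc (f x) _ _))

  ∑-≥ : ∀ {x} xs (f : A → ℕ) → x ∈ˡ xs → f x ≤ ∑ xs f
  ∑-≥ (y ∷ xs) f (here refl) = m≤m+n (f y) _
  ∑-≥ (y ∷ xs) f (there x∈) = ≤-trans (∑-≥ xs f x∈) (m≤n+m _ (f y))

  ∑-pos : ∀ xs (f : A → ℕ) → 0 < ∑ xs f → ∃ λ x → 0 < f x
  ∑-pos (x ∷ xs) f pos with f x in eq
  ... | suc _ = x , subst (0 <_) (sym eq) z<s
  ... | zero  = ∑-pos xs f pos

  ∑<length⇒∃≡0 : ∀ xs (f : A → ℕ) → ∑ xs f < length xs → ∃ λ x → f x ≡ 0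
  ∑<length⇒∃≡0 (x ∷ xs) f lt with f x in eq
  ... | zero  = x , eq
  ... | suc _ = ∑<length⇒∃≡0 xs f (≤-trans (s≤s (m≤n+m _ _)) (s≤s⁻¹ lt))

module _ {A B : Set} where

  ∑-map : ∀ (h : A → B) xs (f : B → ℕ) → ∑ (map h xs) f ≡ ∑ xs (f ∘ h)
  ∑-map h []       f = refl
  ∑-map h (x ∷ xs) f = cong (f (h x) +_) (∑-map h xs f)

  ∑-concatMap : ∀ (h : A → List B) xs (f : B → ℕ) → ∑ (concatMap h xs) f ≡ ∑[ x ← xs ] ∑ (h x) f
  ∑-concatMap h []       f = refl
  ∑-concatMap h (x ∷ xs) f = trans (∑-++ (h x) (concatMap h xs) f) (cong (∑ (h x) f +_) (∑-concatMap h xs f))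

  ∑-comm : ∀ xs ys (g : A → B → ℕ) → ∑[ x ← xs ] ∑ ys (g x) ≡ ∑[ y ← ys ] ∑[ x ← xs ] g x y
  ∑-comm []       ys g = sym (∑-0 ys)
  ∑-comm (x ∷ xs) ys g = trans (cong (∑ ys (g x) +_) (∑-comm xs ys g)) (sym (∑-distrib-+ ys (g x) _))

module _ {A : Set} where

  ∏ : ∀ {m} → Vec A m → (A → ℕ) → ℕ
  ∏ []       f = 1
  ∏ (x ∷ xs) f = f x * ∏ xs f

  syntax ∏ xs (λ x → e) = ∏[ x ← xs ] e

  ∏≡0⇒∃≡0 : ∀ {m} (v : Vec A m) (f : A → ℕ) → ∏ v f ≡ 0 → ∃ λ i → f (lookup v i) ≡ 0
  ∏≡0⇒∃≡0 (x ∷ v) f eq with m*n≡0⇒m≡0∨n≡0 (f x) eq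
  ... | inj₁ fx≡0 = zero , fx≡0
  ... | inj₂ ∏≡0 with ∏≡0⇒∃≡0 v f ∏≡0
  ... | i , fi≡0 = suc i , fi≡0

  vecs : List A → (m : ℕ) → List (Vec A m)
  vecs xs zero    = [] ∷ []
  vecs xs (suc m) = concatMap (λ a → map (a ∷_) (vecs xs m)) xs

  ∈-vecs : ∀ {xs} → (∀ x → x ∈ˡ xs) → ∀ {m} (v : Vec A m) → v ∈ˡ vecs xs m
  ∈-vecs complete []      = here refl
  ∈-vecs complete (x ∷ v) = ∈-concatMap⁺ _ (Any.map (λ { refl → ∈-map⁺ (x ∷_) (∈-vecs complete v) }) (complete x))

  ∑-vecs : ∀ xs m (f : Vec A (suc m) → ℕ) → ∑ (vecs xs (suc m)) f ≡ ∑[ a ← xs ] ∑[ v ← vecs xs m ] f (a ∷ v)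
  ∑-vecs xs m f = trans (∑-concatMap _ xs f) (∑-cong xs (λ a → ∑-map (a ∷_) (vecs xs m) f))

  ∑-vecs-product : ∀ xs m (g : A → ℕ) → ∑[ v ← vecs xs m ] ∏[ x ← v ] g x ≡ ∑ xs g ^ m
  ∑-vecs-product xs zero    g = refl
  ∑-vecs-product xs (suc m) g = begin
    ∑[ v ← vecs xs (suc m) ] ∏[ x ← v ] g x                 ≡⟨ ∑-vecs xs m _ ⟩
    ∑[ a ← xs ] ∑[ v ← vecs xs m ] (g a * ∏[ x ← v ] g x)  ≡⟨ ∑-cong xs (λ a → ∑-*ˡ (vecs xs m) (g a) _) ⟩
    ∑[ a ← xs ] (g a * ∑[ v ← vecs xs m ] ∏[ x ← v ] g x)  ≡⟨ ∑-*ʳ xs _ g ⟩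
    ∑ xs g * ∑[ v ← vecs xs m ] ∏[ x ← v ] g x              ≡⟨ cong (∑ xs g *_) (∑-vecs-product xs m g) ⟩
    ∑ xs g * ∑ xs g ^ m                                      ∎
    where open ≡-Reasoning

  length-vecs : ∀ xs m → length (vecs xs m) ≡ length xs ^ m
  length-vecs xs zero    = refl
  length-vecs xs (suc m) = begin
    length (vecs xs (suc m))                ≡⟨ length≡∑1 (vecs xs (suc m)) ⟩
    ∑[ _ ← vecs xs (suc m) ] 1              ≡⟨ ∑-vecs xs m _ ⟩
    ∑[ _ ← xs ] ∑[ _ ← vecs xs m ] 1        ≡⟨ ∑-cong xs (λ _ → sym (length≡∑1 (vecs xs m))) ⟩
    ∑[ _ ← xs ] length (vecs xs m)          ≡⟨ ∑-const xs _ ⟩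
    length xs * length (vecs xs m)          ≡⟨ cong (length xs *_) (length-vecs xs m) ⟩
    length xs * length xs ^ m               ∎
    where open ≡-Reasoning

∑-tabulate : ∀ {A : Set} {n} (g : Fin n → A) (f : A → ℕ) → ∑ (tabulate g) f ≡ ∑ (allFin n) (f ∘ g)
∑-tabulate {n = zero}  g f = refl
∑-tabulate {n = suc n} g f = cong (f (g zero) +_) (trans (∑-tabulate (g ∘ suc) f) (sym (∑-tabulate suc (f ∘ g))))

∑-allFin-suc : ∀ {n} (f : Fin (suc n) → ℕ) → ∑ (allFin (suc n)) f ≡ f zero + ∑ (allFin n) (f ∘ suc)
∑-allFin-suc f = cong (f zero +_) (∑-tabulate suc f)

∑-allFin-const : ∀ n k → ∑[ _ ← allFin n ] k ≡ n * k
∑-allFin-const n k = trans (∑-const (allFin n) k) (cong (_* k) (length-tabulate {n = n} id))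

-- Colourings, colour classes and class sizes

Colouring : ℕ → ℕ → Set
Colouring N b = Vec (Fin b) N

module _ {N b : ℕ} where

  colourClass : Colouring N b → Fin b → Subset N
  colourClass c j = Vec.map (λ a → does (a ≟ j)) c

  ∈-colourClass⇒ : ∀ c j x → x ∈ colourClass c j → lookup c x ≡ j
  ∈-colourClass⇒ c j x x∈ with lookup c x ≟ j | trans (sym (lookup-map x _ c)) ([]=⇒lookup x∈)
  ... | yes eq | _  = eq
  ... | no _   | ()

  colourClasses : Colouring N b → Partition N b
  colourClasses c = record
    { part     = colourClass c
    ; disjoint = λ j k x x∈j x∈k → trans (sym (∈-colourClass⇒ c j x x∈j)) (∈-colourClass⇒ c k x x∈k)
    ; covers   = λ x → lookup c x , lookup⇒[]= x _ (trans (lookup-map x _ c) (dec-true (lookup c x ≟ lookup c x) refl))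
    }

Isolates : ∀ {N b K} → ℕ → (Fin K → Partition N b) → Set
Isolates {N} n P = ∀ (V : Subset N) → Nonempty V → ∣ V ∣ ≤ n → ∃ λ i → ∃ λ j → ∣ part (P i) j ∩ V ∣ ≡ 1

Counts : ℕ → Set
Counts b = Fin b → ℕ

noCounts : ∀ {b} → Counts b
noCounts _ = 0

module _ {b : ℕ} where

  bump : Fin b → Counts b → Counts b
  bump a s j = if does (a ≟ j) then suc (s j) else s j

  tally : ∀ {N} → Counts b → Colouring N b → Subset N → Counts b
  tally s []      []          = s
  tally s (a ∷ c) (true ∷ V)  = tally (bump a s) c V
  tally s (a ∷ c) (false ∷ V) = tally s c V

  tally-colourClass : ∀ {N} s (c : Colouring N b) V j → tally s c V j ≡ s j + ∣ colourClass c j ∩ V ∣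
  tally-colourClass s []      []          j = sym (+-identityʳ (s j))
  tally-colourClass s (a ∷ c) (false ∷ V) j with does (a ≟ j)
  ... | true  = tally-colourClass s c V j
  ... | false = tally-colourClass s c V j
  tally-colourClass s (a ∷ c) (true ∷ V)  j with tally-colourClass (bump a s) c V j
  ... | eq with a ≟ j
  ...   | yes _ = trans eq (sym (+-suc (s j) _))
  ...   | no  _ = eq

∑-bump : ∀ {b} (φ : ℕ → ℕ) (a : Fin b) (s : Counts b) →
         ∑[ j ← allFin b ] φ (bump a s j) + φ (s a) ≡ ∑[ j ← allFin b ] φ (s j) + φ (suc (s a))
∑-bump {suc b} φ zero s = begin
  ∑[ j ← allFin (suc b) ] φ (bump zero s j) + φ (s zero) ≡⟨ cong (_+ φ (s zero)) (∑-allFin-suc (φ ∘ bump zero s)) ⟩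
  φ (suc (s zero)) + S + φ (s zero)                       ≡⟨ x+y+z≡z+y+x (φ (suc (s zero))) S (φ (s zero)) ⟩
  φ (s zero) + S + φ (suc (s zero))                       ≡⟨ cong (_+ φ (suc (s zero))) (∑-allFin-suc (φ ∘ s)) ⟨
  ∑[ j ← allFin (suc b) ] φ (s j) + φ (suc (s zero))     ∎
  where
  open ≡-Reasoning
  S = ∑[ j ← allFin b ] φ (s (suc j))
  x+y+z≡z+y+x : ∀ x y z → x + y + z ≡ z + y + x
  x+y+z≡z+y+x = solve-∀
∑-bump {suc b} φ (suc a) s = begin
  ∑[ j ← allFin (suc b) ] φ (bump (suc a) s j) + φ (s (suc a))            ≡⟨ cong (_+ φ (s (suc a))) (∑-allFin-suc (φ ∘ bump (suc a) s)) ⟩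
  φ (s zero) + ∑[ j ← allFin b ] φ (bump a (s ∘ suc) j) + φ (s (suc a))   ≡⟨ +-assoc (φ (s zero)) _ _ ⟩
  φ (s zero) + (∑[ j ← allFin b ] φ (bump a (s ∘ suc) j) + φ (s (suc a))) ≡⟨ cong (φ (s zero) +_) (∑-bump φ a (s ∘ suc)) ⟩
  φ (s zero) + (∑[ j ← allFin b ] φ (s (suc j)) + φ (suc (s (suc a))))    ≡⟨ +-assoc (φ (s zero)) _ _ ⟨
  φ (s zero) + ∑[ j ← allFin b ] φ (s (suc j)) + φ (suc (s (suc a)))      ≡⟨ cong (_+ φ (suc (s (suc a)))) (∑-allFin-suc (φ ∘ s)) ⟨
  ∑[ j ← allFin (suc b) ] φ (s j) + φ (suc (s (suc a)))                   ∎
  where open ≡-Reasoning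

caseSize : ∀ {A : Set} → ℕ → A → A → A → A
caseSize zero          x₀ x₁ x₂ = x₀
caseSize (suc zero)    x₀ x₁ x₂ = x₁
caseSize (suc (suc _)) x₀ x₁ x₂ = x₂

δ₀ δ₁ δ₂ : ℕ → ℕ
δ₀ k = caseSize k 1 0 0
δ₁ k = caseSize k 0 1 0
δ₂ k = caseSize k 0 0 1

caseSize-δ : ∀ k x₀ x₁ x₂ → caseSize k x₀ x₁ x₂ ≡ δ₀ k * x₀ + δ₁ k * x₁ + δ₂ k * x₂
caseSize-δ zero          x₀ x₁ x₂ = sym (trans (+-identityʳ _) (trans (+-identityʳ _) (+-identityʳ x₀)))
caseSize-δ (suc zero)    x₀ x₁ x₂ = sym (trans (+-identityʳ _) (+-identityʳ x₁))
caseSize-δ (suc (suc k)) x₀ x₁ x₂ = sym (+-identityʳ x₂)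

module _ {b : ℕ} where

  #empty #single #multi : Counts b → ℕ
  #empty  s = ∑[ j ← allFin b ] δ₀ (s j)
  #single s = ∑[ j ← allFin b ] δ₁ (s j)
  #multi  s = ∑[ j ← allFin b ] δ₂ (s j)

  #empty+#single+#multi : ∀ s → #empty s + #single s + #multi s ≡ b
  #empty+#single+#multi s = begin
    #empty s + #single s + #multi s                           ≡⟨ cong (_+ #multi s) (∑-distrib-+ (allFin b) (δ₀ ∘ s) (δ₁ ∘ s)) ⟨
    ∑[ j ← allFin b ] (δ₀ (s j) + δ₁ (s j)) + #multi s        ≡⟨ ∑-distrib-+ (allFin b) _ (δ₂ ∘ s) ⟨
    ∑[ j ← allFin b ] (δ₀ (s j) + δ₁ (s j) + δ₂ (s j))        ≡⟨ ∑-cong (allFin b) (λ j → δ₀+δ₁+δ₂≡1 (s j)) ⟩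
    ∑[ j ← allFin b ] 1                                       ≡⟨ ∑-allFin-const b 1 ⟩
    b * 1                                                     ≡⟨ *-identityʳ b ⟩
    b                                                         ∎
    where
    open ≡-Reasoning
    δ₀+δ₁+δ₂≡1 : ∀ k → δ₀ k + δ₁ k + δ₂ k ≡ 1
    δ₀+δ₁+δ₂≡1 zero          = refl
    δ₀+δ₁+δ₂≡1 (suc zero)    = refl
    δ₀+δ₁+δ₂≡1 (suc (suc k)) = refl

  #single-bump : ∀ a s → #single (bump a s) ≡ caseSize (s a) (suc (#single s)) (#single s ∸ 1) (#single s)
  #single-bump a s with s a | ∑-bump δ₁ a s
  ... | zero          | eq = trans (sym (+-identityʳ _)) (trans eq (+-comm (#single s) 1))
  ... | suc zero      | eq = trans (sym (m+n∸n≡m _ 1)) (cong (_∸ 1) (trans eq (+-identityʳ _)))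
  ... | suc (suc _)   | eq = trans (sym (+-identityʳ _)) (trans eq (+-identityʳ _))

  #multi-bump : ∀ a s → #multi (bump a s) ≡ caseSize (s a) (#multi s) (suc (#multi s)) (#multi s)
  #multi-bump a s with s a | ∑-bump δ₂ a s
  ... | zero          | eq = trans (sym (+-identityʳ _)) (trans eq (+-identityʳ _))
  ... | suc zero      | eq = trans (sym (+-identityʳ _)) (trans eq (+-comm (#multi s) 1))
  ... | suc (suc _)   | eq = +-cancelʳ-≡ 1 _ _ eq

  ∑-bump-byClass : ∀ (F : ℕ → ℕ → ℕ) s → let u = #single s ; t = #multi s in
    ∑[ a ← allFin b ] F (#single (bump a s)) (#multi (bump a s)) ≡
      #empty s * F (suc u) t + u * F (u ∸ 1) (suc t) + t * F u t
  ∑-bump-byClass F s = begin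
    ∑[ a ← allFin b ] F (#single (bump a s)) (#multi (bump a s))
      ≡⟨ ∑-cong (allFin b) (λ a → trans (cong₂ F (#single-bump a s) (#multi-bump a s)) (F-caseSize (s a))) ⟩
    ∑[ a ← allFin b ] caseSize (s a) F₀ F₁ F₂
      ≡⟨ ∑-cong (allFin b) (λ a → caseSize-δ (s a) F₀ F₁ F₂) ⟩
    ∑[ a ← allFin b ] (δ₀ (s a) * F₀ + δ₁ (s a) * F₁ + δ₂ (s a) * F₂)
      ≡⟨ ∑-distrib-+ (allFin b) _ _ ⟩
    ∑[ a ← allFin b ] (δ₀ (s a) * F₀ + δ₁ (s a) * F₁) + ∑[ a ← allFin b ] (δ₂ (s a) * F₂)
      ≡⟨ cong₂ _+_ (∑-distrib-+ (allFin b) _ _) (∑-*ʳ (allFin b) F₂ (δ₂ ∘ s)) ⟩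
    ∑[ a ← allFin b ] (δ₀ (s a) * F₀) + ∑[ a ← allFin b ] (δ₁ (s a) * F₁) + #multi s * F₂
      ≡⟨ cong (λ x → x + #multi s * F₂) (cong₂ _+_ (∑-*ʳ (allFin b) F₀ (δ₀ ∘ s)) (∑-*ʳ (allFin b) F₁ (δ₁ ∘ s))) ⟩
    #empty s * F₀ + #single s * F₁ + #multi s * F₂
      ∎
    where
    open ≡-Reasoning
    u = #single s
    t = #multi s
    F₀ = F (suc u) t
    F₁ = F (u ∸ 1) (suc t)
    F₂ = F u t
    F-caseSize : ∀ k → F (caseSize k (suc u) (u ∸ 1) u) (caseSize k t (suc t) t) ≡ caseSize k F₀ F₁ F₂
    F-caseSize zero          = refl
    F-caseSize (suc zero)    = refl
    F-caseSize (suc (suc _)) = refl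

  ∑-tally : ∀ {N} s (c : Colouring N b) V → ∑[ j ← allFin b ] tally s c V j ≡ ∑[ j ← allFin b ] s j + ∣ V ∣
  ∑-tally s []      []          = sym (+-identityʳ _)
  ∑-tally s (a ∷ c) (false ∷ V) = ∑-tally s c V
  ∑-tally s (a ∷ c) (true ∷ V)  = begin
    ∑[ j ← allFin b ] tally (bump a s) c V j   ≡⟨ ∑-tally (bump a s) c V ⟩
    ∑[ j ← allFin b ] bump a s j + ∣ V ∣       ≡⟨ cong (_+ ∣ V ∣) ∑-bump-a-s ⟩
    suc (∑[ j ← allFin b ] s j) + ∣ V ∣        ≡⟨ +-suc _ ∣ V ∣ ⟨
    ∑[ j ← allFin b ] s j + suc ∣ V ∣          ∎
    where
    open ≡-Reasoning
    ∑-bump-a-s : ∑[ j ← allFin b ] bump a s j ≡ suc (∑[ j ← allFin b ] s j)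
    ∑-bump-a-s = +-cancelʳ-≡ (s a) _ _ (trans (∑-bump id a s) (+-suc _ (s a)))

  -- the indicator of #single s ≡ 0
  noSingleton : Counts b → ℕ
  noSingleton s = 1 ∸ #single s

  noSingleton≤1 : ∀ s → noSingleton s ≤ 1
  noSingleton≤1 s = m∸n≤m 1 (#single s)

  noSingleton≡0⇒∃≡1 : ∀ s → noSingleton s ≡ 0 → ∃ λ j → s j ≡ 1
  noSingleton≡0⇒∃≡1 s eq with ∑-pos (allFin b) (δ₁ ∘ s) (m∸n≡0⇒m≤n eq)
  ... | j , pos = j , δ₁-pos (s j) pos
    where
    δ₁-pos : ∀ k → 0 < δ₁ k → k ≡ 1
    δ₁-pos zero          ()
    δ₁-pos (suc zero)    _ = refl
    δ₁-pos (suc (suc _)) ()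

  noSingleton-∣V∣≡1 : ∀ {N} (c : Colouring N b) V → ∣ V ∣ ≡ 1 → noSingleton (tally noCounts c V) ≡ 0
  noSingleton-∣V∣≡1 c V ∣V∣≡1 =
    m≤n⇒m∸n≡0 (≤-trans (subst (λ k → 1 ≤ δ₁ k) (sym s′j≡1) ≤-refl) (∑-≥ (allFin b) (δ₁ ∘ s′) (∈-allFin j)))
    where
    s′ = tally noCounts c V
    total≡1 : ∑[ j ← allFin b ] s′ j ≡ 1
    total≡1 = trans (∑-tally _ c V) (cong₂ _+_ (∑-0 (allFin b)) ∣V∣≡1)
    occupied : ∃ λ j → 0 < s′ j
    occupied = ∑-pos (allFin b) s′ (subst (0 <_) (sym total≡1) z<s)
    j = proj₁ occupied
    s′j≡1 : s′ j ≡ 1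
    s′j≡1 = ≤-antisym (subst (s′ j ≤_) total≡1 (∑-≥ (allFin b) s′ (∈-allFin j))) (proj₂ occupied)

-- A potential for counting colourings

-- halfPow e X Y is 2·X^(e/2) for even e and Y·X^((e-1)/2) for odd e.  Below X = M·b and
-- Y = M + b ≥ 2√X, so it plays the role of 2·√X^e while staying in ℕ.
halfPow : ℕ → ℕ → ℕ → ℕ
halfPow zero          X Y = 2
halfPow (suc zero)    X Y = Y
halfPow (suc (suc e)) X Y = X * halfPow e X Y

halfPow-step : ∀ e z t {X Y X′ Y′} → X′ ≤ X → Y′ ≤ Y →
  2 * z + t * Y ≤ 2 * X → z * Y + 2 * t * X ≤ X * Y →
  z * halfPow e X Y + t * halfPow (suc e) X′ Y′ ≤ X * halfPow e X Y
halfPow-step zero z t {X} {Y} {X′} {Y′} X′≤X Y′≤Y base₀ base₁ = begin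
  z * 2 + t * Y′ ≤⟨ +-monoʳ-≤ (z * 2) (*-monoʳ-≤ t Y′≤Y) ⟩
  z * 2 + t * Y  ≡⟨ cong (_+ t * Y) (*-comm z 2) ⟩
  2 * z + t * Y  ≤⟨ base₀ ⟩
  2 * X          ≡⟨ *-comm 2 X ⟩
  X * 2          ∎
  where open ≤-Reasoning
halfPow-step (suc zero) z t {X} {Y} {X′} {Y′} X′≤X Y′≤Y base₀ base₁ = begin
  z * Y + t * (X′ * 2) ≤⟨ +-monoʳ-≤ (z * Y) (*-monoʳ-≤ t (*-monoˡ-≤ 2 X′≤X)) ⟩
  z * Y + t * (X * 2)  ≡⟨ cong (z * Y +_) (rearrange t X) ⟩
  z * Y + 2 * t * X    ≤⟨ base₁ ⟩
  X * Y                ∎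
  where
  open ≤-Reasoning
  rearrange : ∀ t X → t * (X * 2) ≡ 2 * t * X
  rearrange = solve-∀
halfPow-step (suc (suc e)) z t {X} {Y} {X′} {Y′} X′≤X Y′≤Y base₀ base₁ = begin
  z * (X * A) + t * (X′ * B) ≤⟨ +-monoʳ-≤ (z * (X * A)) (*-monoʳ-≤ t (*-monoˡ-≤ B X′≤X)) ⟩
  z * (X * A) + t * (X * B)  ≡⟨ factor z X A t B ⟩
  X * (z * A + t * B)        ≤⟨ *-monoʳ-≤ X (halfPow-step e z t X′≤X Y′≤Y base₀ base₁) ⟩
  X * (X * A)                ∎
  where
  open ≤-Reasoning
  A = halfPow e X Y
  B = halfPow (suc e) X′ Y′
  factor : ∀ z X A t B → z * (X * A) + t * (X * B) ≡ X * (z * A + t * B)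
  factor = solve-∀

binomial-≤ : ∀ R u → R ^ u + u * R ^ (u ∸ 1) ≤ suc R ^ u
binomial-≤ R zero          = ≤-refl
binomial-≤ R (suc zero)    = ≤-reflexive (expand R)
  where
  expand : ∀ R → R * 1 + 1 * 1 ≡ suc R * 1
  expand = solve-∀
binomial-≤ R (suc (suc u)) = begin
  R * (R * P) + suc (suc u) * (R * P)             ≤⟨ m≤m+n _ (suc u * P) ⟩
  R * (R * P) + suc (suc u) * (R * P) + suc u * P ≡⟨ factor R P u ⟩
  suc R * (R * P + suc u * P)                     ≤⟨ *-monoʳ-≤ (suc R) (binomial-≤ R (suc u)) ⟩
  suc R * suc R ^ suc u                           ∎
  where
  open ≤-Reasoning
  P = R ^ u
  factor : ∀ R P u → R * (R * P) + suc (suc u) * (R * P) + suc u * P ≡ suc R * (R * P + suc u * P)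
  factor = solve-∀

binomial-absorb : ∀ R u W P Q → P + Q ≤ R ^ u * W → P + u * (R ^ (u ∸ 1) * W) + Q ≤ suc R ^ u * W
binomial-absorb R u W P Q P+Q≤ = begin
  P + u * (E * W) + Q    ≡⟨ rearrange P u E W Q ⟩
  (P + Q) + u * E * W    ≤⟨ +-monoˡ-≤ (u * E * W) P+Q≤ ⟩
  R ^ u * W + u * E * W  ≡⟨ *-distribʳ-+ W (R ^ u) (u * E) ⟨
  (R ^ u + u * E) * W    ≤⟨ *-monoˡ-≤ W (binomial-≤ R u) ⟩
  suc R ^ u * W          ∎
  where
  open ≤-Reasoning
  E = R ^ (u ∸ 1)
  rearrange : ∀ P u E W Q → P + u * (E * W) + Q ≡ (P + Q) + u * E * W
  rearrange = solve-∀

-- Twice the number of ways to colour the r remaining points of V so that no class ends with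
-- exactly one of them, when u classes hold one point and t hold at least two, is at most
-- potential b r u t.  It vanishes for r < u since each singleton class must be hit again.
potential : ℕ → ℕ → ℕ → ℕ → ℕ
potential b r u t with u ≤? r
... | yes _ = r ^ u * halfPow (r ∸ u) ((r + u + 2 * t) * b) ((r + u + 2 * t) + b)
... | no  _ = 0

potential-≤ : ∀ b {r u} t e → r ≡ u + e →
              potential b r u t ≡ r ^ u * halfPow e ((r + u + 2 * t) * b) ((r + u + 2 * t) + b)
potential-≤ b {u = u} t e refl with u ≤? u + e
... | yes _   = cong (λ k → (u + e) ^ u * halfPow k (M * b) (M + b)) (m+n∸m≡n u e)
  where M = u + e + u + 2 * t
... | no  u≰r = contradiction (m≤m+n u e) u≰r

potential-> : ∀ b {r u} t → r < u → potential b r u t ≡ 0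
potential-> b {r} {u} t r<u with u ≤? r
... | yes u≤r = contradiction u≤r (<⇒≱ r<u)
... | no  _   = refl

data Excess (u r : ℕ) : Set where
  surplus : ∀ e → r ≡ u + e → Excess u r
  one-short : u ≡ suc r → Excess u r
  several-short : suc r < u → Excess u r

compare-excess : ∀ u r → Excess u r
compare-excess zero          r       = surplus r refl
compare-excess (suc zero)    zero    = one-short refl
compare-excess (suc (suc u)) zero    = several-short (s≤s (s≤s z≤n))
compare-excess (suc u)       (suc r) with compare-excess u r
... | surplus e eq      = surplus e (cong suc eq)
... | one-short eq     = one-short (cong suc eq)
... | several-short lt = several-short (s≤s lt)

≤-via-+ : ∀ {m n k} → n ≡ m + k → m ≤ n
≤-via-+ {m} {k = k} refl = m≤m+n m k

module _ (z u t r : ℕ) where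

  private
    M = suc r + u + 2 * t
    B = z + u + t

  halfPow-step-base₀ : 2 * (z * r) + t * (M + B) ≤ 2 * (M * B)
  halfPow-step-base₀ = ≤-via-+ (expand z u t r)
    where
    expand : ∀ z u t r → 2 * ((suc r + u + 2 * t) * (z + u + t)) ≡
      (2 * (z * r) + t * ((suc r + u + 2 * t) + (z + u + t))) +
      (t + t * r + t * t + 2 * u + 2 * u * r + 4 * u * t + 2 * u * u + 2 * z + 3 * z * t + 2 * z * u)
    expand = solve-∀

  halfPow-step-base₁ : (z * r) * (M + B) + 2 * t * (M * B) ≤ (M * B) * (M + B)
  halfPow-step-base₁ = ≤-via-+ (expand z u t r)
    where
    expand : ∀ z u t r → ((suc r + u + 2 * t) * (z + u + t)) * ((suc r + u + 2 * t) + (z + u + t)) ≡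
      ((z * r) * ((suc r + u + 2 * t) + (z + u + t)) + 2 * t * ((suc r + u + 2 * t) * (z + u + t))) +
      (t + 2 * t * r + t * r * r + 3 * t * t + 3 * t * t * r + 2 * t * t * t + u + 2 * u * r + u * r * r
       + 6 * u * t + 6 * u * t * r + 7 * u * t * t + 3 * u * u + 3 * u * u * r + 7 * u * u * t + 2 * u * u * u
       + z + z * r + 4 * z * t + z * t * r + 4 * z * t * t + 4 * z * u + 2 * z * u * r + 8 * z * u * t
       + 3 * z * u * u + z * z + 2 * z * z * t + z * z * u)
    expand = solve-∀

M-after-merge : ∀ r u t → r + u + 2 * suc t ≡ suc r + suc u + 2 * t
M-after-merge = solve-∀

M-after-new : ∀ r u t → r + suc u + 2 * t ≡ suc r + u + 2 * t
M-after-new = solve-∀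

potential-after-merge : ∀ b u t e {r} → r ≡ u + e →
  u * potential b r (u ∸ 1) (suc t) ≡ u * (r ^ (u ∸ 1) * halfPow (suc e) ((suc r + u + 2 * t) * b) ((suc r + u + 2 * t) + b))
potential-after-merge b zero    t e eq = refl
potential-after-merge b (suc u) t e {r} eq = cong (suc u *_) (trans (potential-≤ b (suc t) (suc e) (trans eq (sym (+-suc u e))))
  (cong (λ m → r ^ u * halfPow (suc e) (m * b) (m + b)) (M-after-merge r u t)))

-- The next point falls into one of z empty classes, u singleton classes or t larger classes.
PotentialStep : ℕ → ℕ → ℕ → ℕ → Set
PotentialStep z u t r =
  z * potential b r (suc u) t + u * potential b r (u ∸ 1) (suc t) + t * potential b r u t ≤ potential b (suc r) u t
  where b = z + u + t

step-several-short : ∀ z u t r → suc r < u → PotentialStep z u t r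
step-several-short z u t r lt
  rewrite potential-> (z + u + t) t (m<n⇒m<1+n (<-trans (n<1+n r) lt))
        | potential-> (z + u + t) (suc t) (∸-monoˡ-≤ 1 lt)
        | potential-> (z + u + t) t (<-trans (n<1+n r) lt)
        | potential-> (z + u + t) t lt
        | *-zeroʳ z | *-zeroʳ u | *-zeroʳ t = ≤-refl

step-one-short : ∀ z t r → PotentialStep z (suc r) t r
step-one-short z t r
  rewrite potential-> (z + suc r + t) t (<-trans (n<1+n r) (n<1+n (suc r)))
        | potential-> (z + suc r + t) t (n<1+n r)
        | potential-≤ (z + suc r + t) (suc t) 0 (sym (+-identityʳ r))
        | potential-≤ (z + suc r + t) t 0 (sym (+-identityʳ (suc r)))
        | *-zeroʳ z | *-zeroʳ t = begin
  suc r * (r ^ r * 2) + 0      ≡⟨ +-identityʳ _ ⟩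
  suc r * (r ^ r * 2)          ≤⟨ *-monoʳ-≤ (suc r) (*-monoˡ-≤ 2 (^-monoˡ-≤ r (n≤1+n r))) ⟩
  suc r * (suc r ^ r * 2)      ≡⟨ *-assoc (suc r) (suc r ^ r) 2 ⟨
  suc r ^ suc r * 2            ∎
  where open ≤-Reasoning

step-exact : ∀ z u t r → r ≡ u → PotentialStep z u t r
step-exact z u t r r≡u
  with r≡u+0 ← trans r≡u (sym (+-identityʳ u))
  rewrite potential-> (z + u + t) t (subst (_< suc u) (sym r≡u) (n<1+n u))
        | potential-after-merge (z + u + t) u t 0 r≡u+0
        | potential-≤ (z + u + t) t 0 r≡u+0
        | potential-≤ (z + u + t) t 1 (trans (cong suc r≡u+0) (sym (+-suc u 0))) =
  binomial-absorb r u (M + (z + u + t)) (z * 0) (t * (r ^ u * 2)) (begin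
    z * 0 + t * (r ^ u * 2)  ≡⟨ cong (_+ t * (r ^ u * 2)) (*-zeroʳ z) ⟩
    t * (r ^ u * 2)          ≡⟨ rearrange t (r ^ u) ⟩
    r ^ u * (2 * t)          ≤⟨ *-monoʳ-≤ (r ^ u) (≤-trans (m≤n+m (2 * t) (suc r + u)) (m≤m+n M (z + u + t))) ⟩
    r ^ u * (M + (z + u + t)) ∎)
  where
  open ≤-Reasoning
  M = suc r + u + 2 * t
  rearrange : ∀ t Q → t * (Q * 2) ≡ Q * (2 * t)
  rearrange = solve-∀

step-surplus : ∀ z u t r e → r ≡ u + suc e → PotentialStep z u t r
step-surplus z u t r e eq
  rewrite potential-≤ (z + u + t) t e (trans eq (+-suc u e))
        | M-after-new r u t
        | potential-after-merge (z + u + t) u t (suc e) eq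
        | potential-≤ (z + u + t) t (suc e) eq
        | potential-≤ (z + u + t) t (suc (suc e)) (trans (cong suc eq) (sym (+-suc u (suc e)))) =
  binomial-absorb r u (X * A) (z * (r ^ suc u * A)) (t * (r ^ u * A′)) (begin
    z * (r * r ^ u * A) + t * (r ^ u * A′) ≡⟨ factor z r (r ^ u) A t A′ ⟩
    r ^ u * ((z * r) * A + t * A′)         ≤⟨ *-monoʳ-≤ (r ^ u) (halfPow-step e (z * r) t X′≤X Y′≤Y
                                                  (halfPow-step-base₀ z u t r) (halfPow-step-base₁ z u t r)) ⟩
    r ^ u * (X * A)                        ∎)
  where
  open ≤-Reasoning
  B  = z + u + t
  M  = suc r + u + 2 * t
  M′ = r + u + 2 * t
  X  = M * B
  Y  = M + B
  A  = halfPow e X Y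
  A′ = halfPow (suc e) (M′ * B) (M′ + B)
  X′≤X : M′ * B ≤ X
  X′≤X = *-monoˡ-≤ B (n≤1+n M′)
  Y′≤Y : M′ + B ≤ Y
  Y′≤Y = +-monoˡ-≤ B (n≤1+n M′)
  factor : ∀ z r Q A t A′ → z * (r * Q * A) + t * (Q * A′) ≡ Q * ((z * r) * A + t * A′)
  factor = solve-∀

potential-step : ∀ b z u t r → b ≡ z + u + t →
  z * potential b r (suc u) t + u * potential b r (u ∸ 1) (suc t) + t * potential b r u t ≤ potential b (suc r) u t
potential-step .(z + u + t) z u t r refl with compare-excess u r
... | several-short lt = step-several-short z u t r lt
... | one-short refl   = step-one-short z t r
... | surplus zero eq  = step-exact z u t r (trans eq (+-identityʳ u))
... | surplus (suc e) eq = step-surplus z u t r e eq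

-- Colourings that isolate no point

colourings : ∀ N b → List (Colouring N b)
colourings N b = vecs (allFin b) N

length-colourings : ∀ N b → length (colourings N b) ≡ b ^ N
length-colourings N b = trans (length-vecs (allFin b) N) (cong (_^ N) (length-tabulate id))

module _ {b : ℕ} where

  #nonIsolating : ∀ {N} → Counts b → Subset N → ℕ
  #nonIsolating {N} s V = ∑[ c ← colourings N b ] noSingleton (tally s c V)

  #nonIsolating-≤ : ∀ {N} (V : Subset N) s →
    2 * #nonIsolating s V ≤ b ^ ∣ ∁ V ∣ * potential b ∣ V ∣ (#single s) (#multi s)
  #nonIsolating-≤ []          s with #single s
  ... | zero  = ≤-refl
  ... | suc k rewrite 0∸n≡0 k = z≤n
  #nonIsolating-≤ {suc N} (false ∷ V) s = begin
    2 * #nonIsolating s (false ∷ V)           ≡⟨ cong (2 *_) (trans (∑-vecs (allFin b) N _) (∑-allFin-const b _)) ⟩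
    2 * (b * #nonIsolating s V)               ≡⟨ x∙yz≈y∙xz 2 b _ ⟩
    b * (2 * #nonIsolating s V)               ≤⟨ *-monoʳ-≤ b (#nonIsolating-≤ V s) ⟩
    b * (b ^ ∣ ∁ V ∣ * P)                    ≡⟨ *-assoc b _ P ⟨
    b ^ suc ∣ ∁ V ∣ * P                      ∎
    where
    open ≤-Reasoning
    P = potential b ∣ V ∣ (#single s) (#multi s)
  #nonIsolating-≤ {suc N} (true ∷ V) s = begin
    2 * #nonIsolating s (true ∷ V)
      ≡⟨ cong (2 *_) (∑-vecs (allFin b) N _) ⟩
    2 * ∑[ a ← allFin b ] #nonIsolating (bump a s) V
      ≡⟨ ∑-*ˡ (allFin b) 2 _ ⟨
    ∑[ a ← allFin b ] (2 * #nonIsolating (bump a s) V)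
      ≤⟨ ∑-mono-≤ (allFin b) (λ a → #nonIsolating-≤ V (bump a s)) ⟩
    ∑[ a ← allFin b ] (b ^ ∣ ∁ V ∣ * P (#single (bump a s)) (#multi (bump a s)))
      ≡⟨ ∑-*ˡ (allFin b) (b ^ ∣ ∁ V ∣) _ ⟩
    b ^ ∣ ∁ V ∣ * ∑[ a ← allFin b ] P (#single (bump a s)) (#multi (bump a s))
      ≡⟨ cong (b ^ ∣ ∁ V ∣ *_) (∑-bump-byClass P s) ⟩
    b ^ ∣ ∁ V ∣ * (#empty s * P (suc u) t + u * P (u ∸ 1) (suc t) + t * P u t)
      ≤⟨ *-monoʳ-≤ (b ^ ∣ ∁ V ∣) (potential-step b (#empty s) u t ∣ V ∣ (sym (#empty+#single+#multi s))) ⟩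
    b ^ ∣ ∁ V ∣ * potential b (suc ∣ V ∣) u t
      ∎
    where
    open ≤-Reasoning
    P = potential b ∣ V ∣
    u = #single s
    t = #multi s

^-distribʳ-* : ∀ m n o → (m * n) ^ o ≡ m ^ o * n ^ o
^-distribʳ-* m n zero    = refl
^-distribʳ-* m n (suc o) = trans (cong (m * n *_) (^-distribʳ-* m n o)) ([m*n]*[o*p]≡[m*o]*[n*p] m n (m ^ o) (n ^ o))

^-comm-^ : ∀ m n o → (m ^ n) ^ o ≡ (m ^ o) ^ n
^-comm-^ m n o = trans (^-*-assoc m n o) (trans (cong (m ^_) (*-comm n o)) (sym (^-*-assoc m o n)))

halfPow-cube-≤ : ∀ {b Q X Y} → X ^ 3 * b ^ 2 ≤ Q ^ 2 → (X * Y) ^ 3 * b ^ 3 ≤ 8 * Q ^ 3 →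
                 ∀ e → halfPow (2 + e) X Y ^ 3 * b ^ (2 + e) ≤ 8 * Q ^ (2 + e)
halfPow-cube-≤ {b} {Q} {X} {Y} two three zero = begin
  (X * 2) ^ 3 * b ^ 2 ≡⟨ rearrange X (b ^ 2) ⟩
  8 * (X ^ 3 * b ^ 2) ≤⟨ *-monoʳ-≤ 8 two ⟩
  8 * Q ^ 2           ∎
  where
  open ≤-Reasoning
  rearrange : ∀ X B → ((X * 2) * ((X * 2) * ((X * 2) * 1))) * B ≡ 8 * ((X * (X * (X * 1))) * B)
  rearrange = solve-∀
halfPow-cube-≤ two three (suc zero) = three
halfPow-cube-≤ {b} {Q} {X} {Y} two three (suc (suc e)) = begin
  (X * H) ^ 3 * (b * (b * P))   ≡⟨ rearrange X H b P ⟩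
  (X ^ 3 * b ^ 2) * (H ^ 3 * P) ≤⟨ *-mono-≤ two (halfPow-cube-≤ {b} {Q} {X} {Y} two three e) ⟩
  Q ^ 2 * (8 * Q ^ (2 + e))     ≡⟨ rearrange′ Q (Q ^ (2 + e)) ⟩
  8 * Q ^ (4 + e)               ∎
  where
  open ≤-Reasoning
  H = halfPow (2 + e) X Y
  P = b ^ (2 + e)
  rearrange : ∀ X H b P → ((X * H) * ((X * H) * ((X * H) * 1))) * (b * (b * P)) ≡
                          ((X * (X * (X * 1))) * (b * (b * 1))) * ((H * (H * (H * 1))) * P)
  rearrange = solve-∀
  rearrange′ : ∀ Q R → (Q * (Q * 1)) * (8 * R) ≡ 8 * (Q * (Q * R))
  rearrange′ = solve-∀

halfPow-diagonal-cube-≤ : ∀ {b n} e → let v = 2 + e in v ≤ n → v ≤ b →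
  halfPow v (v * b) (v + b) ^ 3 * b ^ v ≤ 8 * (b ^ 3 * n) ^ v
halfPow-diagonal-cube-≤ {b} {n} e v≤n v≤b = halfPow-cube-≤ {b} {b ^ 3 * n} {v * b} {v + b} X³b²≤Q² [XY]³b³≤8Q³ e
  where
  open ≤-Reasoning
  v = 2 + e
  X³b²≤Q² : (v * b) ^ 3 * b ^ 2 ≤ (b ^ 3 * n) ^ 2
  X³b²≤Q² = begin
    (v * b) ^ 3 * b ^ 2    ≡⟨ expand₁ v b ⟩
    v ^ 3 * b ^ 5          ≤⟨ *-monoˡ-≤ (b ^ 5) (*-mono-≤ v≤b (*-mono-≤ v≤n (*-mono-≤ v≤n ≤-refl))) ⟩
    b * n ^ 2 * b ^ 5      ≡⟨ expand₂ b n ⟩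
    (b ^ 3 * n) ^ 2        ∎
    where
    expand₁ : ∀ v b → (v * b) * ((v * b) * ((v * b) * 1)) * (b * (b * 1)) ≡
                      v * (v * (v * 1)) * (b * (b * (b * (b * (b * 1)))))
    expand₁ = solve-∀
    expand₂ : ∀ b n → b * (n * (n * 1)) * (b * (b * (b * (b * (b * 1))))) ≡
                      (b * (b * (b * 1)) * n) * ((b * (b * (b * 1)) * n) * 1)
    expand₂ = solve-∀
  [XY]³b³≤8Q³ : (v * b * (v + b)) ^ 3 * b ^ 3 ≤ 8 * (b ^ 3 * n) ^ 3
  [XY]³b³≤8Q³ = begin
    (v * b * (v + b)) ^ 3 * b ^ 3 ≤⟨ *-monoˡ-≤ (b ^ 3) (^-monoˡ-≤ 3 (*-monoʳ-≤ (v * b) (+-monoˡ-≤ b v≤b))) ⟩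
    (v * b * (b + b)) ^ 3 * b ^ 3 ≡⟨ expand₁ v b ⟩
    8 * (v ^ 3 * b ^ 9)           ≤⟨ *-monoʳ-≤ 8 (*-monoˡ-≤ (b ^ 9) (^-monoˡ-≤ 3 v≤n)) ⟩
    8 * (n ^ 3 * b ^ 9)           ≡⟨ expand₂ b n ⟩
    8 * (b ^ 3 * n) ^ 3           ∎
    where
    expand₁ : ∀ v b → let w = v * b * (b + b) in w * (w * (w * 1)) * (b * (b * (b * 1))) ≡
                      8 * (v * (v * (v * 1)) * (b * (b * (b * (b * (b * (b * (b * (b * (b * 1))))))))))
    expand₁ = solve-∀
    expand₂ : ∀ b n → let q = b * (b * (b * 1)) * n in
                      8 * (n * (n * (n * 1)) * (b * (b * (b * (b * (b * (b * (b * (b * (b * 1)))))))))) ≡ 8 * (q * (q * (q * 1)))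
    expand₂ = solve-∀

^-cube-split : ∀ b n c v → (b ^ c) ^ 3 * (b ^ 3 * n) ^ v ≡ (b ^ (c + v)) ^ 3 * n ^ v
^-cube-split b n c v = begin
  (b ^ c) ^ 3 * (b ^ 3 * n) ^ v         ≡⟨ cong ((b ^ c) ^ 3 *_) (^-distribʳ-* (b ^ 3) n v) ⟩
  (b ^ c) ^ 3 * ((b ^ 3) ^ v * n ^ v)   ≡⟨ *-assoc ((b ^ c) ^ 3) _ _ ⟨
  (b ^ c) ^ 3 * (b ^ 3) ^ v * n ^ v     ≡⟨ cong (λ x → (b ^ c) ^ 3 * x * n ^ v) (^-comm-^ b 3 v) ⟩
  (b ^ c) ^ 3 * (b ^ v) ^ 3 * n ^ v     ≡⟨ cong (_* n ^ v) (^-distribʳ-* (b ^ c) (b ^ v) 3) ⟨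
  (b ^ c * b ^ v) ^ 3 * n ^ v           ≡⟨ cong (λ x → x ^ 3 * n ^ v) (^-distribˡ-+-* b c v) ⟨
  (b ^ (c + v)) ^ 3 * n ^ v             ∎
  where open ≡-Reasoning

∣p∣+∣∁p∣≡n : ∀ {n} (p : Subset n) → ∣ p ∣ + ∣ ∁ p ∣ ≡ n
∣p∣+∣∁p∣≡n p = trans (cong (∣ p ∣ +_) (∣∁p∣≡n∸∣p∣ p)) (m+[n∸m]≡n (∣p∣≤n p))

module _ {N b : ℕ} where

  #nonIsolating≤#colourings : ∀ s (V : Subset N) → #nonIsolating s V ≤ b ^ N
  #nonIsolating≤#colourings s V = begin
    #nonIsolating s V                      ≤⟨ ∑-mono-≤ (colourings N b) (λ c → noSingleton≤1 (tally s c V)) ⟩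
    ∑[ _ ← colourings N b ] 1             ≡⟨ length≡∑1 (colourings N b) ⟨
    length (colourings N b)               ≡⟨ length-colourings N b ⟩
    b ^ N                                 ∎
    where open ≤-Reasoning

  #nonIsolating-∣V∣≡1 : ∀ (V : Subset N) → ∣ V ∣ ≡ 1 → #nonIsolating noCounts V ≡ 0
  #nonIsolating-∣V∣≡1 V ∣V∣≡1 = trans (∑-cong (colourings N b) (λ c → noSingleton-∣V∣≡1 c V ∣V∣≡1)) (∑-0 (colourings N b))

  #nonIsolating-noCounts-≤ : ∀ (V : Subset N) → let v = ∣ V ∣ in
    2 * #nonIsolating noCounts V ≤ b ^ ∣ ∁ V ∣ * halfPow v (v * b) (v + b)
  #nonIsolating-noCounts-≤ V = subst (λ P → 2 * #nonIsolating noCounts V ≤ b ^ ∣ ∁ V ∣ * P) potential-v-0-0 (#nonIsolating-≤ V noCounts)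
    where
    v = ∣ V ∣
    potential-v-0-0 : potential b v (#single {b} noCounts) (#multi {b} noCounts) ≡ halfPow v (v * b) (v + b)
    potential-v-0-0 = begin
      potential b v (#single {b} noCounts) (#multi {b} noCounts) ≡⟨ cong₂ (potential b v) (∑-0 (allFin b)) (∑-0 (allFin b)) ⟩
      potential b v 0 0                                           ≡⟨ potential-≤ b {v} {0} 0 v refl ⟩
      1 * halfPow v ((v + 0 + 0) * b) ((v + 0 + 0) + b)           ≡⟨ *-identityˡ _ ⟩
      halfPow v ((v + 0 + 0) * b) ((v + 0 + 0) + b)              ≡⟨ cong (λ m → halfPow v (m * b) (m + b)) v+0+0≡v ⟩
      halfPow v (v * b) (v + b)                                   ∎
      where
      open ≡-Reasoning
      v+0+0≡v : v + 0 + 0 ≡ v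
      v+0+0≡v = trans (+-identityʳ (v + 0)) (+-identityʳ v)

  -- Cubing absorbs the factor 2 of #nonIsolating-noCounts-≤ and the factor Y ≤ 2b of halfPow.
  #nonIsolating-cube-≤ : ∀ {n} (V : Subset N) → ∣ V ∣ ≤ n → ∣ V ∣ ≤ b →
    #nonIsolating noCounts V ^ 3 * b ^ ∣ V ∣ ≤ (b ^ N) ^ 3 * n ^ ∣ V ∣
  #nonIsolating-cube-≤ {n} V v≤n v≤b with ∣ V ∣ in ∣V∣≡v
  ... | zero = *-monoˡ-≤ 1 (^-monoˡ-≤ 3 (#nonIsolating≤#colourings noCounts V))
  ... | suc zero rewrite #nonIsolating-∣V∣≡1 V ∣V∣≡v = z≤n
  ... | v@(suc (suc e)) = *-cancelˡ-≤ 8 (begin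
    8 * (F ^ 3 * b ^ v)               ≡⟨ rearrange F (b ^ v) ⟩
    (2 * F) ^ 3 * b ^ v               ≤⟨ *-monoˡ-≤ (b ^ v) (^-monoˡ-≤ 3 2F≤BW) ⟩
    (B * W) ^ 3 * b ^ v               ≡⟨ rearrange′ B W (b ^ v) ⟩
    B ^ 3 * (W ^ 3 * b ^ v)           ≤⟨ *-monoʳ-≤ (B ^ 3) (halfPow-diagonal-cube-≤ e v≤n v≤b) ⟩
    B ^ 3 * (8 * (b ^ 3 * n) ^ v)     ≡⟨ x∙yz≈y∙xz (B ^ 3) 8 _ ⟩
    8 * (B ^ 3 * (b ^ 3 * n) ^ v)     ≡⟨ cong (8 *_) (^-cube-split b n ∣ ∁ V ∣ v) ⟩
    8 * ((b ^ (∣ ∁ V ∣ + v)) ^ 3 * n ^ v) ≡⟨ cong (λ k → 8 * ((b ^ k) ^ 3 * n ^ v)) ∁+v≡N ⟩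
    8 * ((b ^ N) ^ 3 * n ^ v)         ∎)
    where
    open ≤-Reasoning
    F = #nonIsolating noCounts V
    B = b ^ ∣ ∁ V ∣
    W = halfPow v (v * b) (v + b)
    2F≤BW : 2 * F ≤ B * W
    2F≤BW = subst (λ v → 2 * F ≤ B * halfPow v (v * b) (v + b)) ∣V∣≡v (#nonIsolating-noCounts-≤ V)
    ∁+v≡N : ∣ ∁ V ∣ + v ≡ N
    ∁+v≡N = trans (+-comm _ v) (subst (λ k → k + ∣ ∁ V ∣ ≡ N) ∣V∣≡v (∣p∣+∣∁p∣≡n V))
    rearrange : ∀ F P → 8 * (F * (F * (F * 1)) * P) ≡ (2 * F) * ((2 * F) * ((2 * F) * 1)) * P
    rearrange = solve-∀
    rearrange′ : ∀ B W P → (B * W) * ((B * W) * ((B * W) * 1)) * P ≡ B * (B * (B * 1)) * (W * (W * (W * 1)) * P)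
    rearrange′ = solve-∀

-- Weighted union bound

𝟙 : ∀ {P : Set} → Dec P → ℕ
𝟙 (yes _) = 1
𝟙 (no  _) = 0

subsets : ∀ N → List (Subset N)
subsets N = vecs (false ∷ true ∷ []) N

module _ (a c : ℕ) where

  weight : ∀ {N} → Subset N → ℕ
  weight V = a ^ ∣ V ∣ * c ^ ∣ ∁ V ∣

  ∑-weight : ∀ N → ∑[ V ← subsets N ] weight V ≡ (a + c) ^ N
  ∑-weight zero    = refl
  ∑-weight (suc N) = begin
    ∑[ V ← subsets (suc N) ] weight V
      ≡⟨ ∑-vecs _ N weight ⟩
    ∑[ V ← subsets N ] (a ^ ∣ V ∣ * (c * c ^ ∣ ∁ V ∣)) + (∑[ V ← subsets N ] (a * a ^ ∣ V ∣ * c ^ ∣ ∁ V ∣) + 0)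
      ≡⟨ cong₂ (λ x y → x + (y + 0)) (pull c) (pull′ a) ⟩
    c * ∑[ V ← subsets N ] weight V + (a * ∑[ V ← subsets N ] weight V + 0)
      ≡⟨ cong (λ x → c * x + (a * x + 0)) (∑-weight N) ⟩
    c * (a + c) ^ N + (a * (a + c) ^ N + 0)
      ≡⟨ collect a c ((a + c) ^ N) ⟩
    (a + c) ^ suc N
      ∎
    where
    open ≡-Reasoning
    pull : ∀ k → ∑[ V ← subsets N ] (a ^ ∣ V ∣ * (k * c ^ ∣ ∁ V ∣)) ≡ k * ∑[ V ← subsets N ] weight V
    pull k = trans (∑-cong (subsets N) (λ V → x∙yz≈y∙xz (a ^ ∣ V ∣) k _)) (∑-*ˡ (subsets N) k weight)
    pull′ : ∀ k → ∑[ V ← subsets N ] (k * a ^ ∣ V ∣ * c ^ ∣ ∁ V ∣) ≡ k * ∑[ V ← subsets N ] weight V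
    pull′ k = trans (∑-cong (subsets N) (λ V → *-assoc k _ _)) (∑-*ˡ (subsets N) k weight)
    collect : ∀ a c z → c * z + (a * z + 0) ≡ (a + c) * z
    collect = solve-∀

  ∑-nonempty-weight : ∀ N → ∑[ V ← subsets N ] (𝟙 (1 ≤? ∣ V ∣) * weight V) + c ^ N ≡ (a + c) ^ N
  ∑-nonempty-weight zero    = refl
  ∑-nonempty-weight (suc N) = begin
    ∑[ V ← subsets (suc N) ] (𝟙 (1 ≤? ∣ V ∣) * weight V) + c * c ^ N
      ≡⟨ cong (_+ c * c ^ N) (∑-vecs _ N _) ⟩
    ∑[ V ← subsets N ] (𝟙 (1 ≤? ∣ V ∣) * (a ^ ∣ V ∣ * (c * c ^ ∣ ∁ V ∣))) + (∑[ V ← subsets N ] (1 * (a * a ^ ∣ V ∣ * c ^ ∣ ∁ V ∣)) + 0) + c * c ^ N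
      ≡⟨ cong₂ (λ x y → x + (y + 0) + c * c ^ N) pull-c pull-a ⟩
    c * S + (a * ∑[ V ← subsets N ] weight V + 0) + c * c ^ N
      ≡⟨ regroup c S a (∑[ V ← subsets N ] weight V) (c ^ N) ⟩
    c * (S + c ^ N) + a * ∑[ V ← subsets N ] weight V
      ≡⟨ cong₂ (λ x y → c * x + a * y) (∑-nonempty-weight N) (∑-weight N) ⟩
    c * (a + c) ^ N + a * (a + c) ^ N
      ≡⟨ *-distribʳ-+ ((a + c) ^ N) c a ⟨
    (c + a) * (a + c) ^ N
      ≡⟨ cong (_* (a + c) ^ N) (+-comm c a) ⟩
    (a + c) ^ suc N
      ∎
    where
    open ≡-Reasoning
    S = ∑[ V ← subsets N ] (𝟙 (1 ≤? ∣ V ∣) * weight V)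
    move-c : ∀ i A c C → i * (A * (c * C)) ≡ c * (i * (A * C))
    move-c = solve-∀
    pull-c : ∑[ V ← subsets N ] (𝟙 (1 ≤? ∣ V ∣) * (a ^ ∣ V ∣ * (c * c ^ ∣ ∁ V ∣))) ≡ c * S
    pull-c = trans (∑-cong (subsets N) (λ V → move-c (𝟙 (1 ≤? ∣ V ∣)) (a ^ ∣ V ∣) c (c ^ ∣ ∁ V ∣))) (∑-*ˡ (subsets N) c _)
    pull-a : ∑[ V ← subsets N ] (1 * (a * a ^ ∣ V ∣ * c ^ ∣ ∁ V ∣)) ≡ a * ∑[ V ← subsets N ] weight V
    pull-a = trans (∑-cong (subsets N) (λ V → trans (*-identityˡ _) (*-assoc a _ _))) (∑-*ˡ (subsets N) a weight)
    regroup : ∀ c S a W d → c * S + (a * W + 0) + c * d ≡ c * (S + d) + a * W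
    regroup = solve-∀

[c+a]^k-increment : ∀ c a k → c * (c + a) ^ k ≤ c * c ^ k + k * a * (c + a) ^ k
[c+a]^k-increment c a zero    = m≤m+n _ _
[c+a]^k-increment c a (suc k) = begin
  c * ((c + a) * X)                                         ≡⟨ x∙yz≈y∙xz c (c + a) X ⟩
  (c + a) * (c * X)                                         ≤⟨ *-monoʳ-≤ (c + a) ([c+a]^k-increment c a k) ⟩
  (c + a) * (c * C + k * a * X)                             ≡⟨ expand c a C k X ⟩
  c * (c * C) + a * (c * C) + k * a * ((c + a) * X)         ≤⟨ +-monoˡ-≤ _ (+-monoʳ-≤ (c * (c * C)) (*-monoʳ-≤ a c*C≤[c+a]X)) ⟩
  c * (c * C) + a * ((c + a) * X) + k * a * ((c + a) * X)   ≡⟨ collect c a C k X ⟩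
  c * (c * C) + suc k * a * ((c + a) * X)                   ∎
  where
  open ≤-Reasoning
  X = (c + a) ^ k
  C = c ^ k
  c*C≤[c+a]X : c * C ≤ (c + a) * X
  c*C≤[c+a]X = ^-monoˡ-≤ (suc k) (m≤m+n c a)
  expand : ∀ c a C k X → (c + a) * (c * C + k * a * X) ≡ c * (c * C) + a * (c * C) + k * a * ((c + a) * X)
  expand = solve-∀
  collect : ∀ c a C k X → c * (c * C) + a * ((c + a) * X) + k * a * ((c + a) * X) ≡ c * (c * C) + suc k * a * ((c + a) * X)
  collect = solve-∀

3*[c+a]^N≤4*c^N : ∀ N a c .{{_ : NonZero c}} → 4 * N * a ≤ c → 3 * (c + a) ^ N ≤ 4 * c ^ N
3*[c+a]^N≤4*c^N N a c 4Na≤c = *-cancelˡ-≤ c (+-cancelʳ-≤ (c * Y) _ _ (begin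
  c * (3 * Y) + c * Y          ≡⟨ regroup c Y ⟩
  4 * (c * Y)                  ≤⟨ *-monoʳ-≤ 4 ([c+a]^k-increment c a N) ⟩
  4 * (c * C + N * a * Y)      ≡⟨ regroup′ c C N a Y ⟩
  c * (4 * C) + 4 * N * a * Y  ≤⟨ +-monoʳ-≤ (c * (4 * C)) (*-monoˡ-≤ Y 4Na≤c) ⟩
  c * (4 * C) + c * Y          ∎))
  where
  open ≤-Reasoning
  Y = (c + a) ^ N
  C = c ^ N
  regroup : ∀ c Y → c * (3 * Y) + c * Y ≡ 4 * (c * Y)
  regroup = solve-∀
  regroup′ : ∀ c C N a Y → 4 * (c * C + N * a * Y) ≡ c * (4 * C) + 4 * N * a * Y
  regroup′ = solve-∀

3*∑-nonempty-weight≤c^N : ∀ N a c .{{_ : NonZero c}} → 4 * N * a ≤ c →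
  3 * ∑[ V ← subsets N ] (𝟙 (1 ≤? ∣ V ∣) * weight a c V) ≤ c ^ N
3*∑-nonempty-weight≤c^N N a c 4Na≤c = +-cancelʳ-≤ (3 * c ^ N) _ _ (begin
  3 * W + 3 * c ^ N       ≡⟨ *-distribˡ-+ 3 W (c ^ N) ⟨
  3 * (W + c ^ N)         ≡⟨ cong (3 *_) (∑-nonempty-weight a c N) ⟩
  3 * (a + c) ^ N         ≡⟨ cong (λ x → 3 * x ^ N) (+-comm a c) ⟩
  3 * (c + a) ^ N         ≤⟨ 3*[c+a]^N≤4*c^N N a c 4Na≤c ⟩
  4 * c ^ N               ∎)
  where
  open ≤-Reasoning
  W = ∑[ V ← subsets N ] (𝟙 (1 ≤? ∣ V ∣) * weight a c V)

admissible : ∀ {N} → ℕ → Subset N → ℕ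
admissible n V = 𝟙 (1 ≤? ∣ V ∣) * 𝟙 (∣ V ∣ ≤? n)

weighted-union-bound : ∀ {N} n a c T (F : Subset N → ℕ) .{{_ : NonZero c}} → 4 * N * a ≤ c →
  (∀ V → 1 ≤ ∣ V ∣ → ∣ V ∣ ≤ n → c ^ N * F V ≤ T * weight a c V) →
  3 * ∑[ V ← subsets N ] (admissible n V * F V) ≤ T
weighted-union-bound {N} n a c T F 4Na≤c bound = *-cancelˡ-≤ (c ^ N) {{m^n≢0 c N}} (begin
  c ^ N * (3 * S)                                              ≡⟨ x∙yz≈y∙xz (c ^ N) 3 S ⟩
  3 * (c ^ N * S)                                              ≡⟨ cong (3 *_) (∑-*ˡ (subsets N) (c ^ N) _) ⟨
  3 * ∑[ V ← subsets N ] (c ^ N * (admissible n V * F V))      ≤⟨ *-monoʳ-≤ 3 (∑-mono-≤ (subsets N) pointwise) ⟩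
  3 * ∑[ V ← subsets N ] (T * (𝟙 (1 ≤? ∣ V ∣) * weight a c V)) ≡⟨ cong (3 *_) (∑-*ˡ (subsets N) T _) ⟩
  3 * (T * W)                                                  ≡⟨ x∙yz≈y∙xz 3 T W ⟩
  T * (3 * W)                                                  ≤⟨ *-monoʳ-≤ T (3*∑-nonempty-weight≤c^N N a c 4Na≤c) ⟩
  T * c ^ N                                                    ≡⟨ *-comm T (c ^ N) ⟩
  c ^ N * T                                                    ∎)
  where
  open ≤-Reasoning
  S = ∑[ V ← subsets N ] (admissible n V * F V)
  W = ∑[ V ← subsets N ] (𝟙 (1 ≤? ∣ V ∣) * weight a c V)
  pointwise : ∀ V → c ^ N * (admissible n V * F V) ≤ T * (𝟙 (1 ≤? ∣ V ∣) * weight a c V)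
  pointwise V with 1 ≤? ∣ V ∣ | ∣ V ∣ ≤? n
  ... | yes 1≤v | yes v≤n rewrite *-identityˡ (F V) | *-identityˡ (weight a c V) = bound V 1≤v v≤n
  ... | yes _   | no  _   rewrite *-zeroʳ (c ^ N) = z≤n
  ... | no  _   | _       rewrite *-zeroʳ (c ^ N) = z≤n

nonempty⇒0<∣p∣ : ∀ {N} (V : Subset N) → Nonempty V → 0 < ∣ V ∣
nonempty⇒0<∣p∣ V (x , x∈V) = ≤-<-trans z≤n (x∈p⇒∣p-x∣<∣p∣ x∈V)

admissible≡1 : ∀ {N} n (V : Subset N) → 1 ≤ ∣ V ∣ → ∣ V ∣ ≤ n → admissible n V ≡ 1
admissible≡1 n V 1≤v v≤n with 1 ≤? ∣ V ∣ | ∣ V ∣ ≤? n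
... | yes _ | yes _  = refl
... | no ¬p | _      = contradiction 1≤v ¬p
... | yes _ | no ¬q  = contradiction v≤n ¬q

∈-subsets : ∀ {N} (V : Subset N) → V ∈ˡ subsets N
∈-subsets = ∈-vecs (λ { false → here refl ; true → there (here refl) })

module _ {N b : ℕ} (n K : ℕ) where

  #missed : Vec (Colouring N b) K → ℕ
  #missed cs = ∑[ V ← subsets N ] (admissible n V * ∏[ c ← cs ] noSingleton (tally noCounts c V))

  ∑-#missed : ∑[ cs ← vecs (colourings N b) K ] #missed cs ≡ ∑[ V ← subsets N ] (admissible n V * #nonIsolating noCounts V ^ K)
  ∑-#missed = trans (∑-comm (vecs (colourings N b) K) (subsets N) _) (∑-cong (subsets N) λ V →
    trans (∑-*ˡ (vecs (colourings N b) K) (admissible n V) _)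
          (cong (admissible n V *_) (∑-vecs-product (colourings N b) K (λ c → noSingleton (tally noCounts c V)))))

  isolating-colourings : ∑[ V ← subsets N ] (admissible n V * #nonIsolating noCounts V ^ K) < (b ^ N) ^ K →
    ∃ λ (cs : Vec (Colouring N b) K) → Isolates n (colourClasses ∘ lookup cs)
  isolating-colourings ∑<bᴺᴷ with ∑<length⇒∃≡0 (vecs (colourings N b) K) #missed ∑#missed<#tuples
    where
    ∑#missed<#tuples : ∑[ cs ← vecs (colourings N b) K ] #missed cs < length (vecs (colourings N b) K)
    ∑#missed<#tuples = subst₂ _<_ (sym ∑-#missed)
      (sym (trans (length-vecs (colourings N b) K) (cong (_^ K) (length-colourings N b)))) ∑<bᴺᴷ
  ... | cs , #missed≡0 = cs , isolates
    where
    isolates : Isolates n (colourClasses ∘ lookup cs)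
    isolates V ne v≤n with ∏≡0⇒∃≡0 cs (λ c → noSingleton (tally noCounts c V)) ∏≡0
      where
      P = ∏[ c ← cs ] noSingleton (tally noCounts c V)
      term≤0 : admissible n V * P ≤ 0
      term≤0 = subst (admissible n V * P ≤_) #missed≡0
                 (∑-≥ (subsets N) (λ U → admissible n U * ∏[ c ← cs ] noSingleton (tally noCounts c U)) (∈-subsets V))
      ∏≡0 : P ≡ 0
      ∏≡0 = trans (sym (*-identityˡ P))
              (n≤0⇒n≡0 (subst (λ k → k * P ≤ 0) (admissible≡1 n V (nonempty⇒0<∣p∣ V ne) v≤n) term≤0))
    ... | i , noSingleton≡0 with noSingleton≡0⇒∃≡1 _ noSingleton≡0
    ... | j , count≡1 = i , j , trans (sym (tally-colourClass noCounts (lookup cs i) V j)) count≡1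

-- Choice of the number of partitions

first-crossing : ∀ {P : ℕ → Set} → Decidable P → ∀ m → P m → ¬ P 0 → ∃ λ L → P (suc L) × ¬ P L
first-crossing P? zero    Pm ¬P0 = contradiction Pm ¬P0
first-crossing P? (suc m) Pm ¬P0 with P? m
... | yes Pm′ = first-crossing P? m Pm′ ¬P0
... | no ¬Pm′ = m , Pm , ¬Pm′

M*n^L≤[1+n]^L : ∀ n M L → L ≡ M * n → 0 < L → M * n ^ L ≤ suc n ^ L
M*n^L≤[1+n]^L n M (suc L) L≡Mn _ = begin
  M * (n * n ^ L)             ≡⟨ *-assoc M n _ ⟨
  M * n * n ^ L               ≡⟨ cong (_* n ^ L) L≡Mn ⟨
  suc L * n ^ L               ≤⟨ m≤n+m (suc L * n ^ L) (n ^ suc L) ⟩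
  n ^ suc L + suc L * n ^ L   ≤⟨ binomial-≤ n (suc L) ⟩
  suc n ^ suc L               ∎
  where open ≤-Reasoning

threshold : ∀ N n b → 1 ≤ N → 1 ≤ n → n < b → ∃ λ L → 4 * N * n ^ suc L ≤ b ^ suc L × ¬ (4 * N * n ^ L ≤ b ^ L)
threshold N n b 1≤N 1≤n n<b = first-crossing (λ L → 4 * N * n ^ L ≤? b ^ L) (4 * N * n) crossed ¬crossed₀
  where
  ¬crossed₀ : ¬ (4 * N * 1 ≤ 1)
  ¬crossed₀ = <⇒≱ (≤-trans (s≤s (s≤s z≤n)) (*-monoˡ-≤ 1 (*-monoʳ-≤ 4 1≤N)))
  crossed : 4 * N * n ^ (4 * N * n) ≤ b ^ (4 * N * n)
  crossed = ≤-trans (M*n^L≤[1+n]^L n (4 * N) _ refl (*-mono-≤ (≤-trans 1≤N (m≤n*m N 4)) 1≤n)) (^-monoˡ-≤ (4 * N * n) n<b)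

[4N]³≤N⁹ : ∀ N → 2 ≤ N → (4 * N) ^ 3 ≤ N ^ 9
[4N]³≤N⁹ N 2≤N = begin
  (4 * N) ^ 3    ≡⟨ expand N ⟩
  2 ^ 6 * N ^ 3  ≤⟨ *-monoˡ-≤ (N ^ 3) (^-monoˡ-≤ 6 2≤N) ⟩
  N ^ 6 * N ^ 3  ≡⟨ ^-distribˡ-+-* N 6 3 ⟨
  N ^ 9          ∎
  where
  open ≤-Reasoning
  expand : ∀ N → (4 * N) * ((4 * N) * ((4 * N) * 1)) ≡ (2 * (2 * (2 * (2 * (2 * (2 * 1)))))) * (N * (N * (N * 1)))
  expand = solve-∀

threshold⇒bound : ∀ p q n b N L → p < q → 2 ≤ N → .{{_ : NonZero b}} → n ^ q ≤ b ^ (q ∸ p) →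
  ¬ (4 * N * n ^ L ≤ b ^ L) → b ^ ((3 * suc L) * p) ≤ b ^ (9 * p) * N ^ (9 * q)
threshold⇒bound p q n b N L p<q 2≤N nᵠ≤bᵠ⁻ᵖ not-crossed = begin
  b ^ ((3 * suc L) * p) ≡⟨ cong (b ^_) (*-comm (3 * suc L) p) ⟩
  b ^ (p * (3 * suc L)) ≡⟨ ^-*-assoc b p (3 * suc L) ⟨
  β ^ (3 * suc L)       ≡⟨ cong (β ^_) (*-comm 3 (suc L)) ⟩
  β ^ (suc L * 3)       ≡⟨ ^-*-assoc β (suc L) 3 ⟨
  (β * β ^ L) ^ 3       ≡⟨ ^-distribʳ-* β (β ^ L) 3 ⟩
  β ^ 3 * (β ^ L) ^ 3   ≤⟨ *-mono-≤ (^-monoʳ-≤ β {{m^n≢0 b p}} {3} {9} (s≤s (s≤s (s≤s z≤n)))) (^-monoˡ-≤ 3 (<⇒≤ βᴸ<[4N]ᵠ)) ⟩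
  β ^ 9 * ((4 * N) ^ q) ^ 3 ≡⟨ cong₂ _*_ (^-*-assoc b p 9) (^-comm-^ (4 * N) q 3) ⟩
  b ^ (p * 9) * ((4 * N) ^ 3) ^ q ≤⟨ *-mono-≤ (≤-reflexive (cong (b ^_) (*-comm p 9))) (^-monoˡ-≤ q ([4N]³≤N⁹ N 2≤N)) ⟩
  b ^ (9 * p) * (N ^ 9) ^ q ≡⟨ cong (b ^ (9 * p) *_) (^-*-assoc N 9 q) ⟩
  b ^ (9 * p) * N ^ (9 * q) ∎
  where
  open ≤-Reasoning
  β = b ^ p
  γ = b ^ (q ∸ p)
  bᵠ≡βγ : b ^ q ≡ β * γ
  bᵠ≡βγ = trans (cong (b ^_) (sym (m+[n∸m]≡n (<⇒≤ p<q)))) (^-distribˡ-+-* b p (q ∸ p))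
  -- From b^L < 4N·n^L, raising to the q-th power and using n^q ≤ b^(q-p) = b^q / b^p.
  βᴸ<[4N]ᵠ : β ^ L < (4 * N) ^ q
  βᴸ<[4N]ᵠ = *-cancelʳ-< (γ ^ L) (β ^ L) ((4 * N) ^ q) (begin-strict
    β ^ L * γ ^ L              ≡⟨ ^-distribʳ-* β γ L ⟨
    (β * γ) ^ L                ≡⟨ cong (_^ L) bᵠ≡βγ ⟨
    (b ^ q) ^ L                ≡⟨ ^-comm-^ b q L ⟩
    (b ^ L) ^ q                <⟨ ^-monoˡ-< q {{>-nonZero (≤-<-trans z≤n p<q)}} (≰⇒> not-crossed) ⟩
    (4 * N * n ^ L) ^ q        ≡⟨ ^-distribʳ-* (4 * N) (n ^ L) q ⟩
    (4 * N) ^ q * (n ^ L) ^ q  ≡⟨ cong ((4 * N) ^ q *_) (^-comm-^ n L q) ⟩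
    (4 * N) ^ q * (n ^ q) ^ L  ≤⟨ *-monoʳ-≤ ((4 * N) ^ q) (^-monoˡ-≤ L nᵠ≤bᵠ⁻ᵖ) ⟩
    (4 * N) ^ q * γ ^ L        ∎)

raise-cube-bound : ∀ F β B n v L → F ^ 3 * β ^ v ≤ B ^ 3 * n ^ v → F ^ (3 * L) * (β ^ L) ^ v ≤ B ^ (3 * L) * (n ^ L) ^ v
raise-cube-bound F β B n v L le = begin
  F ^ (3 * L) * (β ^ L) ^ v   ≡⟨ cong₂ _*_ (^-*-assoc F 3 L) (^-comm-^ β v L) ⟨
  (F ^ 3) ^ L * (β ^ v) ^ L   ≡⟨ ^-distribʳ-* (F ^ 3) (β ^ v) L ⟨
  (F ^ 3 * β ^ v) ^ L         ≤⟨ ^-monoˡ-≤ L le ⟩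
  (B ^ 3 * n ^ v) ^ L         ≡⟨ ^-distribʳ-* (B ^ 3) (n ^ v) L ⟩
  (B ^ 3) ^ L * (n ^ v) ^ L   ≡⟨ cong₂ _*_ (^-*-assoc B 3 L) (^-comm-^ n v L) ⟩
  B ^ (3 * L) * (n ^ L) ^ v   ∎
  where open ≤-Reasoning

3*m≤n⇒m<n : ∀ {m n} → 0 < n → 3 * m ≤ n → m < n
3*m≤n⇒m<n {zero}  0<n _    = 0<n
3*m≤n⇒m<n {suc m} _   3m≤n = <-≤-trans (subst (suc m <_) (*-comm (suc m) 3) (m<m*n (suc m) 3 (s≤s (s≤s z≤n)))) 3m≤n

colourClasses-isolate-singletons : ∀ {N b} n (c : Colouring N b) → (∀ (V : Subset N) → Nonempty V → ∣ V ∣ ≤ n → ∣ V ∣ ≡ 1) →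
  Isolates n (λ (_ : Fin 1) → colourClasses c)
colourClasses-isolate-singletons n c singleton V ne v≤n with noSingleton≡0⇒∃≡1 _ (noSingleton-∣V∣≡1 c V (singleton V ne v≤n))
... | j , count≡1 = zero , j , trans (sym (tally-colourClass noCounts c V j)) count≡1

singleton-family : ∀ p q n b N → .{{_ : NonZero b}} → 0 < N → (∀ (V : Subset N) → Nonempty V → ∣ V ∣ ≤ n → ∣ V ∣ ≡ 1) →
  Σ ℕ λ K → (b ^ (K * p) ≤ b ^ (9 * p) * N ^ (9 * q)) × Σ (Fin K → Partition N b) (Isolates n)
singleton-family p q n b@(suc _) N 0<N singleton =
  1 , bound , (λ _ → colourClasses (replicate N zero)) , colourClasses-isolate-singletons n (replicate N zero) singleton
  where
  bound : b ^ (1 * p) ≤ b ^ (9 * p) * N ^ (9 * q)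
  bound = ≤-trans (^-monoʳ-≤ b (≤-trans (≤-reflexive (+-identityʳ p)) (m≤n*m p 9)))
                  (m≤m*n (b ^ (9 * p)) (N ^ (9 * q)) {{m^n≢0 N (9 * q) {{>-nonZero 0<N}}}})

module Nontrivial (p q n b N : ℕ) (0<p : 0 < p) (p<q : p < q) (2≤n : 2 ≤ n) (2≤N : 2 ≤ N) .{{_ : NonZero b}}
            (nᵠ≤bᵠ⁻ᵖ : n ^ q ≤ b ^ (q ∸ p)) where

  n<b : n < b
  n<b with n <? b
  ... | yes n<b = n<b
  ... | no  n≮b = contradiction nᵠ≤bᵠ⁻ᵖ (<⇒≱ (≤-<-trans (^-monoˡ-≤ (q ∸ p) (≮⇒≥ n≮b)) (^-monoʳ-< n 2≤n (∸-monoʳ-< 0<p (<⇒≤ p<q)))))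

  crossing : ∃ λ L → 4 * N * n ^ suc L ≤ b ^ suc L × ¬ (4 * N * n ^ L ≤ b ^ L)
  crossing = threshold N n b (≤-trans (s≤s z≤n) 2≤N) (≤-trans (s≤s z≤n) 2≤n) n<b

  L K c a : ℕ
  L = proj₁ crossing
  K = 3 * suc L
  c = b ^ suc L
  a = n ^ suc L

  per-subset : ∀ (V : Subset N) → 1 ≤ ∣ V ∣ → ∣ V ∣ ≤ n →
               c ^ N * #nonIsolating noCounts V ^ K ≤ (b ^ N) ^ K * weight a c V
  per-subset V _ v≤n = begin
    c ^ N * F ^ K                          ≡⟨ cong (λ k → c ^ k * F ^ K) (∣p∣+∣∁p∣≡n V) ⟨
    c ^ (v + ∣ ∁ V ∣) * F ^ K              ≡⟨ cong (_* F ^ K) (^-distribˡ-+-* c v ∣ ∁ V ∣) ⟩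
    c ^ v * c ^ ∣ ∁ V ∣ * F ^ K            ≡⟨ rotate (c ^ v) (c ^ ∣ ∁ V ∣) (F ^ K) ⟩
    F ^ K * c ^ v * c ^ ∣ ∁ V ∣            ≤⟨ *-monoˡ-≤ (c ^ ∣ ∁ V ∣) (raise-cube-bound F b (b ^ N) n v (suc L)
                                                  (#nonIsolating-cube-≤ V v≤n (<⇒≤ (≤-<-trans v≤n n<b)))) ⟩
    (b ^ N) ^ K * a ^ v * c ^ ∣ ∁ V ∣      ≡⟨ *-assoc ((b ^ N) ^ K) (a ^ v) (c ^ ∣ ∁ V ∣) ⟩
    (b ^ N) ^ K * weight a c V             ∎
    where
    open ≤-Reasoning
    F = #nonIsolating noCounts V
    v = ∣ V ∣
    rotate : ∀ x y z → x * y * z ≡ z * x * y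
    rotate x y z = trans (*-comm (x * y) z) (sym (*-assoc z x y))

  isolating-family : Σ ℕ λ K → (b ^ (K * p) ≤ b ^ (9 * p) * N ^ (9 * q)) × Σ (Fin K → Partition N b) (Isolates n)
  isolating-family = K , threshold⇒bound p q n b N L p<q 2≤N nᵠ≤bᵠ⁻ᵖ (proj₂ (proj₂ crossing))
                   , colourClasses ∘ lookup (proj₁ chosen) , proj₂ chosen
    where
    3∑≤T : 3 * ∑[ V ← subsets N ] (admissible n V * #nonIsolating noCounts V ^ K) ≤ (b ^ N) ^ K
    3∑≤T = weighted-union-bound n a c ((b ^ N) ^ K) (λ V → #nonIsolating noCounts V ^ K) {{m^n≢0 b (suc L)}}
             (proj₁ (proj₂ crossing)) per-subset
    chosen : ∃ λ (cs : Vec (Colouring N b) K) → Isolates n (colourClasses ∘ lookup cs)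
    chosen = isolating-colourings n K (3*m≤n⇒m<n (m^n>0 (b ^ N) {{m^n≢0 b N}} K) 3∑≤T)

lemma2p4 : Σ ℕ λ C →
    ∀ (p q n b N : ℕ) → 0 < p → p < q → 0 < n → 0 < b → 0 < N →
    n ^ q ≤ b ^ (q ∸ p) →
    Σ ℕ λ K → (b ^ (K * p) ≤ b ^ (C * p) * N ^ (C * q)) ×
      Σ (Fin K → Partition N b) λ P →
        ∀ (V : Subset N) → Nonempty V → ∣ V ∣ ≤ n →
          ∃ λ (i : Fin K) → ∃ λ (j : Fin b) → ∣ part (P i) j ∩ V ∣ ≡ 1
lemma2p4 = 9 , isolating-partitions
  where
  isolating-partitions : ∀ (p q n b N : ℕ) → 0 < p → p < q → 0 < n → 0 < b → 0 < N → n ^ q ≤ b ^ (q ∸ p) →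
    Σ ℕ λ K → (b ^ (K * p) ≤ b ^ (9 * p) * N ^ (9 * q)) × Σ (Fin K → Partition N b) (Isolates n)
  isolating-partitions p q n b@(suc _) N 0<p p<q _ _ 0<N nᵠ≤bᵠ⁻ᵖ with 2 ≤? n | 2 ≤? N
  ... | yes 2≤n | yes 2≤N = Nontrivial.isolating-family p q n b N 0<p p<q 2≤n 2≤N nᵠ≤bᵠ⁻ᵖ
  ... | no n≱2  | _       = singleton-family p q n b N 0<N
                              (λ V ne v≤n → ≤-antisym (≤-trans v≤n (≤-pred (≰⇒> n≱2))) (nonempty⇒0<∣p∣ V ne))
  ... | yes _   | no N≱2  = singleton-family p q n b N 0<N
                              (λ V ne _ → ≤-antisym (≤-trans (∣p∣≤n V) (≤-pred (≰⇒> N≱2))) (nonempty⇒0<∣p∣ V ne))
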